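{- Let $q$ be a prime power, $n\ge1$, $\alpha\in\mathbb{F}_{q^n}\setminus\mathbb{F}_q$ and $$M(X)=X^{q^2}-\big(1+(\alpha^q-\alpha)^{q-1}\big)X^q+(\alpha^q-\alpha)^{q-1}X.$$ Let $H_1,H_2:\mathbb{F}_{q^n}\to\mathbb{F}_{q^n}$ and $\beta_1,\beta_2\in\mathbb{F}_{q^n}$ be arbitrary. Then $$F(X)=X+Tr\big(H_1(M(X))+\beta_1X\big)+\alpha\,Tr\big(H_2(M(X))+\beta_2X\big)$$ is a permutation polynomial of $\mathbb{F}_{q^n}$ if either (i) $Tr(\beta_1)\neq-1$ and $Tr(\alpha\beta_2)-\frac{Tr(\alpha\beta_1)Tr(\beta_2)}{Tr(\beta_1)+1}\neq-1$; or (ii) $Tr(\alpha\beta_2)\neq-1$ and $Tr(\beta_1)-\frac{Tr(\beta_2)Tr(\alpha\beta_1)}{Tr(\alpha\beta_2)+1}\neq-1$.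
   Context: $Tr$ denotes the trace map from $\mathbb{F}_{q^n}$ to $\mathbb{F}_q$, $Tr(y)=y+y^q+\dots+y^{q^{n-1}}$. -}

module Defs where

open import Level using (0ℓ)
open import Data.Nat using (ℕ; zero; suc)
import Data.Nat as ℕ
open import Data.Fin using (Fin)
open import Data.Product using (Σ; _×_)
open import Relation.Nullary using (¬_)
open import Algebra.Bundles using (CommutativeRing)
open import Relation.Binary.PropositionalEquality using (_≡_)
import Relation.Binary.PropositionalEquality as P
open import Function.Bundles using (Inverse)
open import Data.Nat.Primality using (Prime)

record FiniteField (N : ℕ) : Set₁ where
  field
    cring : CommutativeRing 0ℓ 0ℓ
  open CommutativeRing cring public
  field
    _⁻¹       : Carrier → Carrier
    0≉1       : ¬ (0# ≈ 1#)
    ⁻¹-inverse : ∀ x → ¬ (x ≈ 0#) → (x * (x ⁻¹)) ≈ 1#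
    enumeration : Inverse (P.setoid (Fin N)) setoid

  _^ᴷ_ : Carrier → ℕ → Carrier
  x ^ᴷ zero  = 1#
  x ^ᴷ suc k = x * (x ^ᴷ k)

  -- division (used only with a nonzero denominator)
  _/_ : Carrier → Carrier → Carrier
  x / y = x * (y ⁻¹)

  Tr : ℕ → ℕ → Carrier → Carrier
  Tr q zero    y = 0#
  Tr q (suc i) y = Tr q i y + (y ^ᴷ (q ℕ.^ i))

IsPrimePower : ℕ → Set
IsPrimePower q = Σ ℕ λ p → Σ ℕ λ k → Prime p × (1 ℕ.≤ k) × (q ≡ p ℕ.^ k)

module Submission where

-- As F_{q^n} is finite it suffices that F is injective.  The q-linearised polynomial
-- M(X) = X^{q²} - (1+γ)X^q + γX, γ = (α^q - α)^{q-1}, is F_q-linear and vanishes on F_q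
-- and at α (γ(α^q - α) = (α^q - α)^q), hence on F_q + F_q α.  If F(x) = F(y) then
-- x - y = a + bα with a, b ∈ F_q (the trace has values in F_q), so M(x) = M(y), the
-- H-terms cancel, and F_q-linearity of Tr leaves the homogeneous system
--     a (Tr β₁ + 1) + b Tr(αβ₁) = 0,      a Tr β₂ + b (Tr(αβ₂) + 1) = 0,
-- whose only solution is a = b = 0 under (i), or under (ii) with a, b swapped.

open import Level using (0ℓ)
open import Algebra.Bundles using (CommutativeRing)
import Algebra.Solver.Ring.AlmostCommutativeRing as ACR
open import Data.Nat as ℕ using (ℕ; zero; suc; _!)
import Data.Nat.Properties as ℕP
open import Data.Nat.Properties using (_!*_!≢0)
open import Data.Nat.Divisibility using (_∣_; divides; ∣⇒≤; ∣1⇒≡1; m∣m*n)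
open import Data.Nat.DivMod using (m/n*n≡m)
open import Data.Nat.Primality using (Prime; euclidsLemma; ¬prime[0]; ¬prime[1]; prime⇒nonZero)
open import Data.Nat.Combinatorics using (_C_; nCk≡n!/k![n-k]!; k![n∸k]!∣n!; nCn≡1)
open import Data.Integer as ℤ using (ℤ; +_; -[1+_]; _⊖_; _◃_; sign; ∣_∣)
import Data.Integer.Properties as ℤP
open import Data.Sign as Sign using (Sign)
open import Data.Fin as Fin using (Fin)
import Data.Fin.Properties as FinP
import Data.Fin.Permutation as Perm
open import Data.Vec.Functional using (removeAt)
open import Data.Maybe using (Maybe; just; nothing)
open import Data.Product using (∃; _,_; proj₁; proj₂)
open import Data.Sum using (_⊎_; inj₁; inj₂)
open import Data.Empty using (⊥-elim)
open import Relation.Nullary using (¬_; Dec; yes; no)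
open import Relation.Nullary.Decidable using (toSum)
open import Relation.Binary.PropositionalEquality as P using (_≡_)
open import Function.Bundles using (Inverse)
open import Function.Definitions using (Congruent; Injective; Surjective; Bijective)
open import Defs

prime∤factorial : ∀ {p} → Prime p → ∀ m → m ℕ.< p → ¬ (p ∣ m !)
prime∤factorial pr zero    _   p∣1 = ¬prime[1] (P.subst Prime (∣1⇒≡1 p∣1) pr)
prime∤factorial pr (suc m) m<p p∣m! with euclidsLemma (suc m) (m !) pr p∣m!
... | inj₁ p∣1+m = ℕP.<⇒≱ m<p (∣⇒≤ p∣1+m)
... | inj₂ p∣m!′ = prime∤factorial pr m (ℕP.<-trans (ℕP.n<1+n m) m<p) p∣m!′

-- A prime p divides the binomial coefficient p C k for 0 < k < p: it divides
-- p! = (p C k)·k!·(p-k)! but neither k! nor (p-k)!.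
prime∣binomial : ∀ {p k} → Prime p → 0 ℕ.< k → k ℕ.< p → p ∣ p C k
prime∣binomial {zero}   {k} pr _   _   = ⊥-elim (¬prime[0] pr)
prime∣binomial {suc p′} {k} pr 0<k k<p
  with euclidsLemma (suc p′ C k) (k ! ℕ.* (suc p′ ℕ.∸ k) !) pr p∣binomial·denominator
  where
  instance
    denominator≢0 : ℕ.NonZero (k ! ℕ.* (suc p′ ℕ.∸ k) !)
    denominator≢0 = k !* (suc p′ ℕ.∸ k) !≢0
  binomial·denominator : (suc p′ C k) ℕ.* (k ! ℕ.* (suc p′ ℕ.∸ k) !) ≡ suc p′ !
  binomial·denominator = P.trans (P.cong (ℕ._* (k ! ℕ.* (suc p′ ℕ.∸ k) !)) (nCk≡n!/k![n-k]! (ℕP.<⇒≤ k<p)))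
                                 (m/n*n≡m (k![n∸k]!∣n! (ℕP.<⇒≤ k<p)))
  p∣binomial·denominator : suc p′ ∣ (suc p′ C k) ℕ.* (k ! ℕ.* (suc p′ ℕ.∸ k) !)
  p∣binomial·denominator = P.subst (suc p′ ∣_) (P.sym binomial·denominator) (m∣m*n (p′ !))
... | inj₁ p∣binomial = p∣binomial
... | inj₂ p∣denominator with euclidsLemma (k !) ((suc p′ ℕ.∸ k) !) pr p∣denominator
...   | inj₁ p∣k! = ⊥-elim (prime∤factorial pr k k<p p∣k!)
...   | inj₂ p∣[p-k]! = ⊥-elim (prime∤factorial pr (suc p′ ℕ.∸ k) (ℕP.∸-monoʳ-< 0<k (ℕP.<⇒≤ k<p)) p∣[p-k]!)

-- Pigeonhole principle: a self-map of Fin (suc m) missing a value y factors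
-- through Fin m by punching out y, so it identifies two distinct points.
missing-value⇒¬injective : ∀ {m} (g : Fin (suc m) → Fin (suc m)) (y : Fin (suc m)) →
                           (∀ i → ¬ y ≡ g i) → ¬ Injective _≡_ _≡_ g
missing-value⇒¬injective {m} g y avoids g-injective
  with i , j , i<j , same ← FinP.pigeonhole (ℕP.n<1+n m) (λ i → Fin.punchOut (avoids i))
  = ℕP.<-irrefl (P.cong Fin.toℕ (g-injective (FinP.punchOut-injective (avoids i) (avoids j) same))) i<j

fin-injective⇒surjective : ∀ {m} (g : Fin m → Fin m) → Injective _≡_ _≡_ g → ∀ y → ∃ λ i → g i ≡ y
fin-injective⇒surjective {suc m} g g-injective y with FinP.any? (λ i → g i Fin.≟ y)
... | yes hit  = hit
... | no  miss = ⊥-elim (missing-value⇒¬injective g y (λ i y≡gi → miss (i , P.sym y≡gi)) g-injective)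

-- A ring solver for an arbitrary commutative ring R, with integer coefficients
-- interpreted through the canonical map ℤ → R.  (Coefficients in R itself would not
-- let the solver decide equality of normal forms for an abstract ring.)
module IntegerCoefficientSolver (R : CommutativeRing 0ℓ 0ℓ) where
  open CommutativeRing R
  open import Algebra.Properties.Semiring.Mult.TCOptimised semiring using (_×_; ×-homo-+; ×1-homo-*)
  open import Algebra.Properties.Ring ring using (-‿distribˡ-*; -‿distribʳ-*; -‿involutive; -0#≈0#; -‿+-comm; xyx⁻¹≈y)
  open import Relation.Binary.Reasoning.Setoid setoid

  signed : Sign → Carrier → Carrier
  signed Sign.+ x = x
  signed Sign.- x = - x

  suc-× : ∀ m → suc m × 1# ≈ 1# + m × 1#
  suc-× m = ×-homo-+ 1# 1 m

  signed-cong : ∀ s {x y} → x ≈ y → signed s x ≈ signed s y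
  signed-cong Sign.+ e = e
  signed-cong Sign.- e = -‿cong e

  signed-* : ∀ s t x y → signed (s Sign.* t) (x * y) ≈ signed s x * signed t y
  signed-* Sign.+ Sign.+ x y = refl
  signed-* Sign.+ Sign.- x y = -‿distribʳ-* x y
  signed-* Sign.- Sign.+ x y = -‿distribˡ-* x y
  signed-* Sign.- Sign.- x y = begin
    x * y         ≈⟨ -‿involutive _ ⟨
    - - (x * y)   ≈⟨ -‿cong (-‿distribʳ-* x y) ⟩
    - (x * - y)   ≈⟨ -‿distribˡ-* x (- y) ⟩
    - x * - y     ∎

  -- The canonical map ℤ → R; the optimised multiple _×_ makes ⟦ + 1 ⟧ℤ reduce to 1#.
  ⟦_⟧ℤ : ℤ → Carrier
  ⟦ i ⟧ℤ = signed (sign i) (∣ i ∣ × 1#)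

  ⟦◃⟧ : ∀ s n → ⟦ s ◃ n ⟧ℤ ≈ signed s (n × 1#)
  ⟦◃⟧ Sign.+ zero    = refl
  ⟦◃⟧ Sign.- zero    = sym -0#≈0#
  ⟦◃⟧ Sign.+ (suc n) = refl
  ⟦◃⟧ Sign.- (suc n) = refl

  ⟦⊖⟧ : ∀ m n → ⟦ m ⊖ n ⟧ℤ ≈ m × 1# - n × 1#
  ⟦⊖⟧ zero    zero    = sym (-‿inverseʳ 0#)
  ⟦⊖⟧ (suc m) zero    = sym (trans (+-congˡ -0#≈0#) (+-identityʳ _))
  ⟦⊖⟧ zero    (suc n) = sym (+-identityˡ _)
  ⟦⊖⟧ (suc m) (suc n) = begin
    ⟦ suc m ⊖ suc n ⟧ℤ              ≡⟨ P.cong ⟦_⟧ℤ (ℤP.[1+m]⊖[1+n]≡m⊖n m n) ⟩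
    ⟦ m ⊖ n ⟧ℤ                      ≈⟨ ⟦⊖⟧ m n ⟩
    m × 1# - n × 1#                 ≈⟨ cancel-common-summand 1# (m × 1#) (n × 1#) ⟨
    (1# + m × 1#) - (1# + n × 1#)   ≈⟨ +-cong (suc-× m) (-‿cong (suc-× n)) ⟨
    suc m × 1# - suc n × 1#         ∎
    where
    cancel-common-summand : ∀ c a b → (c + a) - (c + b) ≈ a - b
    cancel-common-summand c a b = begin
      (c + a) - (c + b)     ≈⟨ +-congˡ (-‿+-comm c b) ⟨
      (c + a) + (- c - b)   ≈⟨ +-assoc _ _ _ ⟨
      ((c + a) - c) - b     ≈⟨ +-congʳ (xyx⁻¹≈y c a) ⟩
      a - b                 ∎

  +-homo : ∀ i j → ⟦ i ℤ.+ j ⟧ℤ ≈ ⟦ i ⟧ℤ + ⟦ j ⟧ℤ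
  +-homo (+ m)    (+ n)    = ×-homo-+ 1# m n
  +-homo (+ m)    -[1+ n ] = ⟦⊖⟧ m (suc n)
  +-homo -[1+ m ] (+ n)    = trans (⟦⊖⟧ n (suc m)) (+-comm _ _)
  +-homo -[1+ m ] -[1+ n ] = begin
    - (suc (suc m ℕ.+ n) × 1#)          ≡⟨ P.cong (λ k → - (suc k × 1#)) (ℕP.+-suc m n) ⟨
    - ((suc m ℕ.+ suc n) × 1#)          ≈⟨ -‿cong (×-homo-+ 1# (suc m) (suc n)) ⟩
    - (suc m × 1# + suc n × 1#)         ≈⟨ -‿+-comm _ _ ⟨
    - (suc m × 1#) + - (suc n × 1#)     ∎

  *-homo : ∀ i j → ⟦ i ℤ.* j ⟧ℤ ≈ ⟦ i ⟧ℤ * ⟦ j ⟧ℤ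
  *-homo i j = begin
    ⟦ (s Sign.* t) ◃ (∣ i ∣ ℕ.* ∣ j ∣) ⟧ℤ             ≈⟨ ⟦◃⟧ (s Sign.* t) (∣ i ∣ ℕ.* ∣ j ∣) ⟩
    signed (s Sign.* t) ((∣ i ∣ ℕ.* ∣ j ∣) × 1#)      ≈⟨ signed-cong (s Sign.* t) (×1-homo-* ∣ i ∣ ∣ j ∣) ⟩
    signed (s Sign.* t) ((∣ i ∣ × 1#) * (∣ j ∣ × 1#)) ≈⟨ signed-* s t _ _ ⟩
    ⟦ i ⟧ℤ * ⟦ j ⟧ℤ                                   ∎
    where
    s = sign i
    t = sign j

  -‿homo : ∀ i → ⟦ ℤ.- i ⟧ℤ ≈ - ⟦ i ⟧ℤ
  -‿homo (+ zero)  = sym -0#≈0#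
  -‿homo (+ suc n) = refl
  -‿homo -[1+ n ]  = sym (-‿involutive _)

  homomorphism : ℤ.+-*-rawRing ACR.-Raw-AlmostCommutative⟶ ACR.fromCommutativeRing R
  homomorphism = record
    { ⟦_⟧ = ⟦_⟧ℤ ; +-homo = +-homo ; *-homo = *-homo ; -‿homo = -‿homo
    ; 0-homo = refl ; 1-homo = refl }

  ℤ-coefficients-equal? : ∀ i j → Maybe (⟦ i ⟧ℤ ≈ ⟦ j ⟧ℤ)
  ℤ-coefficients-equal? i j with i ℤ.≟ j
  ... | yes i≡j = just (reflexive (P.cong ⟦_⟧ℤ i≡j))
  ... | no  _   = nothing

  open import Algebra.Solver.Ring ℤ.+-*-rawRing (ACR.fromCommutativeRing R) homomorphism ℤ-coefficients-equal? public

-- The basic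
-- example is the Frobenius exponent p in characteristic p; closure under products
-- then gives every power of p, in particular q.
module AdditivePowers (R : CommutativeRing 0ℓ 0ℓ) where
  open CommutativeRing R
  open import Algebra.Properties.CommutativeSemiring.Exp commutativeSemiring using (_^_; ^-congˡ; ^-assocʳ)
  open import Algebra.Properties.Semiring.Mult semiring using (_×_; ×-congʳ; ×-assoc-*; ×1-homo-*)
  open import Algebra.Properties.Ring ring using (+-inverseˡ-unique; +-identityˡ-unique)
  import Algebra.Properties.CommutativeSemiring.Binomial commutativeSemiring as Binomial
  import Algebra.Properties.CommutativeMonoid.Sum +-commutativeMonoid as Sum
  open import Relation.Binary.Reasoning.Setoid setoid

  Additive : ℕ → Set
  Additive e = ∀ x y → (x + y) ^ e ≈ x ^ e + y ^ e

  ^-identityʳ : ∀ x → x ^ 1 ≈ x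
  ^-identityʳ = *-identityʳ

  additive-* : ∀ a b → Additive a → Additive b → Additive (a ℕ.* b)
  additive-* a b a-additive b-additive x y = begin
    (x + y) ^ (a ℕ.* b)              ≈⟨ ^-assocʳ (x + y) a b ⟨
    ((x + y) ^ a) ^ b                ≈⟨ ^-congˡ b (a-additive x y) ⟩
    (x ^ a + y ^ a) ^ b              ≈⟨ b-additive _ _ ⟩
    (x ^ a) ^ b + (y ^ a) ^ b        ≈⟨ +-cong (^-assocʳ x a b) (^-assocʳ y a b) ⟩
    x ^ (a ℕ.* b) + y ^ (a ℕ.* b)    ∎

  additive-^ : ∀ a → Additive a → ∀ j → Additive (a ℕ.^ j)
  additive-^ a a-additive zero x y =
    trans (^-identityʳ (x + y)) (+-cong (sym (^-identityʳ x)) (sym (^-identityʳ y)))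
  additive-^ a a-additive (suc j) = additive-* a (a ℕ.^ j) a-additive (additive-^ a a-additive j)

  additive⇒0^e≈0 : ∀ e → Additive e → 0# ^ e ≈ 0#
  additive⇒0^e≈0 e e-additive = +-identityˡ-unique (0# ^ e) (0# ^ e)
    (trans (sym (e-additive 0# 0#)) (^-congˡ e (+-identityˡ 0#)))

  additive-neg : ∀ e → Additive e → ∀ x → (- x) ^ e ≈ - (x ^ e)
  additive-neg e e-additive x = +-inverseˡ-unique ((- x) ^ e) (x ^ e)
    (trans (sym (e-additive (- x) x)) (trans (^-congˡ e (-‿inverseˡ x)) (additive⇒0^e≈0 e e-additive)))

  additive-sub : ∀ e → Additive e → ∀ x y → (x - y) ^ e ≈ x ^ e - y ^ e
  additive-sub e e-additive x y = trans (e-additive x (- y)) (+-congˡ (additive-neg e e-additive y))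

  multiple-vanishes : ∀ {p m} → p × 1# ≈ 0# → p ∣ m → ∀ x → m × x ≈ 0#
  multiple-vanishes {p} p·1≈0 (divides c P.refl) x = begin
    (c ℕ.* p) × x                  ≈⟨ ×-congʳ (c ℕ.* p) (*-identityˡ x) ⟨
    (c ℕ.* p) × (1# * x)           ≈⟨ ×-assoc-* (c ℕ.* p) 1# x ⟨
    ((c ℕ.* p) × 1#) * x           ≈⟨ *-congʳ (×1-homo-* c p) ⟩
    ((c × 1#) * (p × 1#)) * x      ≈⟨ *-congʳ (*-congˡ p·1≈0) ⟩
    ((c × 1#) * 0#) * x            ≈⟨ *-congʳ (zeroʳ _) ⟩
    0# * x                         ≈⟨ zeroˡ x ⟩
    0#                             ∎

  -- Frobenius: for a prime p with p·1 = 0 the exponent p is additive, since all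
  -- inner binomial coefficients of (x + y)^p are divisible by p.
  frobenius : ∀ {p} → Prime p → p × 1# ≈ 0# → Additive p
  frobenius {zero}   pr _ = ⊥-elim (¬prime[0] pr)
  frobenius {suc p′} pr p·1≈0 x y = begin
    (x + y) ^ p                                                  ≈⟨ Binomial.theorem p x y ⟩
    term 0 + Sum.sum {p} (λ i → term (Fin.toℕ (Fin.suc i)))      ≈⟨ +-congˡ (Sum.sum-init-last {p′} inner) ⟩
    term 0 + (Sum.sum {p′} (λ i → inner (Fin.inject₁ i)) + inner (Fin.fromℕ p′))
                                                                 ≈⟨ +-cong outer-y (+-cong inner-vanish outer-x) ⟩
    y ^ p + (0# + x ^ p)                                         ≈⟨ +-congˡ (+-identityˡ _) ⟩
    y ^ p + x ^ p                                                ≈⟨ +-comm _ _ ⟩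
    x ^ p + y ^ p                                                ∎
    where
    p = suc p′
    term : ℕ → Carrier
    term k = (p C k) × (x ^ k * y ^ (p ℕ.∸ k))
    inner : Fin p → Carrier
    inner i = term (suc (Fin.toℕ i))
    outer-y : term 0 ≈ y ^ p
    outer-y = trans (+-identityʳ _) (*-identityˡ _)
    outer-x : inner (Fin.fromℕ p′) ≈ x ^ p
    outer-x = begin
      term (suc (Fin.toℕ (Fin.fromℕ p′)))  ≡⟨ P.cong (λ k → term (suc k)) (FinP.toℕ-fromℕ p′) ⟩
      (p C p) × (x ^ p * y ^ (p ℕ.∸ p))    ≡⟨ P.cong₂ (λ c k → c × (x ^ p * y ^ k)) (nCn≡1 p) (ℕP.n∸n≡0 p) ⟩
      1 × (x ^ p * 1#)                     ≈⟨ +-identityʳ _ ⟩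
      x ^ p * 1#                           ≈⟨ *-identityʳ _ ⟩
      x ^ p                                ∎
    inner-vanish : Sum.sum {p′} (λ i → inner (Fin.inject₁ i)) ≈ 0#
    inner-vanish = trans (Sum.sum-cong-≋ {p′} {_} {λ _ → 0#} vanishes) (Sum.sum-replicate-zero p′)
      where
      vanishes : ∀ i → inner (Fin.inject₁ i) ≈ 0#
      vanishes i = multiple-vanishes p·1≈0 (prime∣binomial pr (ℕ.s≤s ℕ.z≤n) (ℕ.s≤s k<p′)) _
        where
        k<p′ : Fin.toℕ (Fin.inject₁ i) ℕ.< p′
        k<p′ = P.subst (ℕ._< p′) (P.sym (FinP.toℕ-inject₁ i)) (FinP.toℕ<n i)

module FiniteFieldTheory {N : ℕ} (K : FiniteField N) where
  open FiniteField K
  open Inverse enumeration using (to; from; from-cong; inverseˡ; inverseʳ)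
  open import Algebra.Properties.CommutativeSemiring.Exp commutativeSemiring public
  open AdditivePowers cring public
  open import Algebra.Properties.Semiring.Mult semiring using (_×_; ×1-homo-*)
  open import Algebra.Properties.Ring ring using (+-identityʳ-unique)
  import Algebra.Properties.CommutativeMonoid.Sum +-commutativeMonoid as Sum
  import Algebra.Properties.CommutativeMonoid.Sum *-commutativeMonoid as Product
  open import Relation.Binary.Reasoning.Setoid setoid

  to∘from : ∀ x → to (from x) ≈ x
  to∘from x = inverseˡ P.refl

  from∘to : ∀ i → from (to i) ≡ i
  from∘to i = inverseʳ refl

  infix 4 _≟_
  _≟_ : ∀ x y → Dec (x ≈ y)
  x ≟ y with from x Fin.≟ from y
  ... | yes same = yes (trans (sym (to∘from x)) (trans (reflexive (P.cong to same)) (to∘from y)))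
  ... | no  differ = no (λ x≈y → differ (from-cong x≈y))

  ⁻¹-inverseˡ : ∀ x → ¬ x ≈ 0# → x ⁻¹ * x ≈ 1#
  ⁻¹-inverseˡ x x≉0 = trans (*-comm _ _) (⁻¹-inverse x x≉0)

  *-cancelˡ-nonzero : ∀ u {x y} → ¬ u ≈ 0# → u * x ≈ u * y → x ≈ y
  *-cancelˡ-nonzero u {x} {y} u≉0 ux≈uy = begin
    x                ≈⟨ *-identityˡ x ⟨
    1# * x           ≈⟨ *-congʳ (⁻¹-inverseˡ u u≉0) ⟨
    (u ⁻¹ * u) * x   ≈⟨ *-assoc _ _ _ ⟩
    u ⁻¹ * (u * x)   ≈⟨ *-congˡ ux≈uy ⟩
    u ⁻¹ * (u * y)   ≈⟨ *-assoc _ _ _ ⟨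
    (u ⁻¹ * u) * y   ≈⟨ *-congʳ (⁻¹-inverseˡ u u≉0) ⟩
    1# * y           ≈⟨ *-identityˡ y ⟩
    y                ∎

  zero-product : ∀ {x y} → x * y ≈ 0# → x ≈ 0# ⊎ y ≈ 0#
  zero-product {x} {y} xy≈0 with x ≟ 0#
  ... | yes x≈0 = inj₁ x≈0
  ... | no  x≉0 = inj₂ (*-cancelˡ-nonzero x x≉0 (trans xy≈0 (sym (zeroʳ x))))

  nonzero-product : ∀ {x y} → ¬ x ≈ 0# → ¬ y ≈ 0# → ¬ x * y ≈ 0#
  nonzero-product x≉0 y≉0 xy≈0 with zero-product xy≈0
  ... | inj₁ x≈0 = x≉0 x≈0
  ... | inj₂ y≈0 = y≉0 y≈0

  ^-zero : ∀ {x} e → x ^ e ≈ 0# → x ≈ 0#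
  ^-zero zero    1≈0 = ⊥-elim (0≉1 (sym 1≈0))
  ^-zero (suc e) x·xᵉ≈0 with zero-product x·xᵉ≈0
  ... | inj₁ x≈0  = x≈0
  ... | inj₂ xᵉ≈0 = ^-zero e xᵉ≈0

  record Automorphism : Set where
    field
      apply unapply : Carrier → Carrier
      apply-cong    : Congruent _≈_ _≈_ apply
      unapply-cong  : Congruent _≈_ _≈_ unapply
      apply-unapply : ∀ x → apply (unapply x) ≈ x
      unapply-apply : ∀ x → unapply (apply x) ≈ x

  index-permutation : Automorphism → Perm.Permutation N N
  index-permutation σ = Perm.permutation (λ i → from (apply (to i))) (λ i → from (unapply (to i)))
    (λ i → P.trans (from-cong (trans (apply-cong (to∘from _)) (apply-unapply (to i)))) (from∘to i))
    (λ i → P.trans (from-cong (trans (unapply-cong (to∘from _)) (unapply-apply (to i)))) (from∘to i))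
    where open Automorphism σ

  ∑ ∏ : (Carrier → Carrier) → Carrier
  ∑ f = Sum.sum (λ i → f (to i))
  ∏ f = Product.sum (λ i → f (to i))

  ∑-reindex : ∀ f → Congruent _≈_ _≈_ f → (σ : Automorphism) → ∑ f ≈ ∑ (λ x → f (Automorphism.apply σ x))
  ∑-reindex f f-cong σ = trans (Sum.sum-permute (λ i → f (to i)) (index-permutation σ))
                               (Sum.sum-cong-≋ {N} (λ i → f-cong (to∘from (Automorphism.apply σ (to i)))))

  ∏-reindex : ∀ f → Congruent _≈_ _≈_ f → (σ : Automorphism) → ∏ f ≈ ∏ (λ x → f (Automorphism.apply σ x))
  ∏-reindex f f-cong σ = trans (Product.sum-permute (λ i → f (to i)) (index-permutation σ))
                               (Product.sum-cong-≋ {N} (λ i → f-cong (to∘from (Automorphism.apply σ (to i)))))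

  translation : Carrier → Automorphism
  translation c = record
    { apply = _+ c ; unapply = _- c ; apply-cong = +-congʳ ; unapply-cong = +-congʳ
    ; apply-unapply = λ x → trans (+-assoc x (- c) c) (trans (+-congˡ (-‿inverseˡ c)) (+-identityʳ x))
    ; unapply-apply = λ x → trans (+-assoc x c (- c)) (trans (+-congˡ (-‿inverseʳ c)) (+-identityʳ x))
    }

  scaling : ∀ a → ¬ a ≈ 0# → Automorphism
  scaling a a≉0 = record
    { apply = a *_ ; unapply = a ⁻¹ *_ ; apply-cong = *-congˡ ; unapply-cong = *-congˡ
    ; apply-unapply = λ x → trans (sym (*-assoc a (a ⁻¹) x)) (trans (*-congʳ (⁻¹-inverse a a≉0)) (*-identityˡ x))
    ; unapply-apply = λ x → trans (sym (*-assoc (a ⁻¹) a x)) (trans (*-congʳ (⁻¹-inverseˡ a a≉0)) (*-identityˡ x))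
    }

  -- The characteristic divides N: shifting every element by 1 does not change
  -- their sum, but adds N·1 to it.
  characteristic : N × 1# ≈ 0#
  characteristic = +-identityʳ-unique (∑ (λ x → x)) (N × 1#) (sym (begin
    ∑ (λ x → x)                          ≈⟨ ∑-reindex (λ x → x) (λ x≈y → x≈y) (translation 1#) ⟩
    ∑ (λ x → x + 1#)                     ≈⟨ Sum.∑-distrib-+ {N} (λ i → to i) (λ _ → 1#) ⟩
    ∑ (λ x → x) + Sum.sum {N} (λ _ → 1#) ≈⟨ +-congˡ (Sum.sum-replicate N) ⟩
    ∑ (λ x → x) + N × 1#                 ∎))

  -- Fermat's little theorem x^N = x, via the units-only product trick: with
  -- unitPart x = (x, or 1 if x = 0), reindexing by y ↦ a·y gives
  -- ∏ unitPart ≈ ∏ scaleFactor a · ∏ unitPart, so ∏ scaleFactor a ≈ 1, where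
  -- scaleFactor a x = (a, or 1 at 0); together with zeroFactor a x = (1, or a at 0)
  -- this yields a^N = ∏ (scaleFactor a · zeroFactor a) = 1 · a.
  ifZero : Carrier → Carrier → Carrier → Carrier
  ifZero x u v with x ≟ 0#
  ... | yes _ = u
  ... | no  _ = v

  ifZero-zero : ∀ {x} u v → x ≈ 0# → ifZero x u v ≈ u
  ifZero-zero {x} u v x≈0 with x ≟ 0#
  ... | yes _   = refl
  ... | no  x≉0 = ⊥-elim (x≉0 x≈0)

  ifZero-nonzero : ∀ {x} u v → ¬ x ≈ 0# → ifZero x u v ≈ v
  ifZero-nonzero {x} u v x≉0 with x ≟ 0#
  ... | yes x≈0 = ⊥-elim (x≉0 x≈0)
  ... | no  _   = refl

  unitPart : Carrier → Carrier
  unitPart x = ifZero x 1# x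

  scaleFactor zeroFactor : Carrier → Carrier → Carrier
  scaleFactor a x = ifZero x 1# a
  zeroFactor  a x = ifZero x a 1#

  unitPart-cong : Congruent _≈_ _≈_ unitPart
  unitPart-cong {x} {y} x≈y with toSum (x ≟ 0#)
  ... | inj₁ x≈0 = trans (ifZero-zero 1# x x≈0) (sym (ifZero-zero 1# y (trans (sym x≈y) x≈0)))
  ... | inj₂ x≉0 = trans (ifZero-nonzero 1# x x≉0)
                        (trans x≈y (sym (ifZero-nonzero 1# y (λ y≈0 → x≉0 (trans x≈y y≈0)))))

  unitPart-nonzero : ∀ x → ¬ unitPart x ≈ 0#
  unitPart-nonzero x with toSum (x ≟ 0#)
  ... | inj₁ x≈0 = λ 1≈0 → 0≉1 (sym (trans (sym (ifZero-zero 1# x x≈0)) 1≈0))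
  ... | inj₂ x≉0 = λ ux≈0 → x≉0 (trans (sym (ifZero-nonzero 1# x x≉0)) ux≈0)

  scale·zero≈a : ∀ a x → scaleFactor a x * zeroFactor a x ≈ a
  scale·zero≈a a x with toSum (x ≟ 0#)
  ... | inj₁ x≈0 = trans (*-cong (ifZero-zero 1# a x≈0) (ifZero-zero a 1# x≈0)) (*-identityˡ a)
  ... | inj₂ x≉0 = trans (*-cong (ifZero-nonzero 1# a x≉0) (ifZero-nonzero a 1# x≉0)) (*-identityʳ a)

  unitPart-scaled : ∀ a → ¬ a ≈ 0# → ∀ x → unitPart (a * x) ≈ scaleFactor a x * unitPart x
  unitPart-scaled a a≉0 x with toSum (x ≟ 0#)
  ... | inj₁ x≈0 = begin
    unitPart (a * x)                ≈⟨ ifZero-zero 1# (a * x) (trans (*-congˡ x≈0) (zeroʳ a)) ⟩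
    1#                              ≈⟨ *-identityˡ 1# ⟨
    1# * 1#                         ≈⟨ *-cong (ifZero-zero 1# a x≈0) (ifZero-zero 1# x x≈0) ⟨
    scaleFactor a x * unitPart x    ∎
  ... | inj₂ x≉0 = begin
    unitPart (a * x)                ≈⟨ ifZero-nonzero 1# (a * x) (nonzero-product a≉0 x≉0) ⟩
    a * x                           ≈⟨ *-cong (ifZero-nonzero 1# a x≉0) (ifZero-nonzero 1# x x≉0) ⟨
    scaleFactor a x * unitPart x    ∎

  product-nonzero : ∀ {m} (f : Fin m → Carrier) → (∀ i → ¬ f i ≈ 0#) → ¬ Product.sum f ≈ 0#
  product-nonzero {zero}  f f≉0 1≈0 = 0≉1 (sym 1≈0)
  product-nonzero {suc m} f f≉0 =
    nonzero-product (f≉0 Fin.zero) (product-nonzero (λ i → f (Fin.suc i)) (λ i → f≉0 (Fin.suc i)))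

  product-single : ∀ {m} (f : Fin m → Carrier) (j : Fin m) → (∀ i → ¬ i ≡ j → f i ≈ 1#) →
                   Product.sum f ≈ f j
  product-single {suc m} f j others≈1 = begin
    Product.sum f                          ≈⟨ Product.sum-remove {i = j} f ⟩
    f j * Product.sum (removeAt f j)       ≈⟨ *-congˡ (Product.sum-cong-≋ {m} {removeAt f j} {λ _ → 1#}
                                                 (λ i → others≈1 _ (FinP.punchInᵢ≢i j i))) ⟩
    f j * Product.sum {m} (λ _ → 1#)       ≈⟨ *-congˡ (Product.sum-replicate-zero m) ⟩
    f j * 1#                               ≈⟨ *-identityʳ (f j) ⟩
    f j                                    ∎

  ∏-scaleFactor : ∀ a → ¬ a ≈ 0# → ∏ (scaleFactor a) ≈ 1#
  ∏-scaleFactor a a≉0 = *-cancelˡ-nonzero (∏ unitPart) (product-nonzero _ (λ i → unitPart-nonzero (to i))) (begin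
    ∏ unitPart * ∏ (scaleFactor a)       ≈⟨ *-comm _ _ ⟩
    ∏ (scaleFactor a) * ∏ unitPart       ≈⟨ Product.∑-distrib-+ {N} (λ i → scaleFactor a (to i)) (λ i → unitPart (to i)) ⟨
    ∏ (λ x → scaleFactor a x * unitPart x) ≈⟨ Product.sum-cong-≋ {N} (λ i → unitPart-scaled a a≉0 (to i)) ⟨
    ∏ (λ x → unitPart (a * x))           ≈⟨ ∏-reindex unitPart unitPart-cong (scaling a a≉0) ⟨
    ∏ unitPart                           ≈⟨ *-identityʳ _ ⟨
    ∏ unitPart * 1#                      ∎)

  ∏-zeroFactor : ∀ a → ∏ (zeroFactor a) ≈ a
  ∏-zeroFactor a = trans (product-single (λ i → zeroFactor a (to i)) (from 0#) others≈1)
                         (ifZero-zero a 1# (to∘from 0#))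
    where
    others≈1 : ∀ i → ¬ i ≡ from 0# → zeroFactor a (to i) ≈ 1#
    others≈1 i i≢0 = ifZero-nonzero a 1# (λ toi≈0 → i≢0 (P.trans (P.sym (from∘to i)) (from-cong toi≈0)))

  fermat : ∀ a → a ^ N ≈ a
  fermat a with toSum (a ≟ 0#)
  ... | inj₁ a≈0 = trans (^-congˡ N a≈0) (trans (0^m≈0 N (from 0#)) (sym a≈0))
    where
    -- N is positive, as K has the element 0
    0^m≈0 : ∀ m → Fin m → 0# ^ m ≈ 0#
    0^m≈0 (suc m) _ = zeroˡ _
  ... | inj₂ a≉0 = begin
    a ^ N                                       ≈⟨ Product.sum-replicate N ⟨
    Product.sum {N} (λ _ → a)                   ≈⟨ Product.sum-cong-≋ {N} (λ i → scale·zero≈a a (to i)) ⟨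
    ∏ (λ x → scaleFactor a x * zeroFactor a x)  ≈⟨ Product.∑-distrib-+ {N} (λ i → scaleFactor a (to i)) (λ i → zeroFactor a (to i)) ⟩
    ∏ (scaleFactor a) * ∏ (zeroFactor a)        ≈⟨ *-cong (∏-scaleFactor a a≉0) (∏-zeroFactor a) ⟩
    1# * a                                      ≈⟨ *-identityˡ a ⟩
    a                                           ∎

  injective⇒surjective : (f : Carrier → Carrier) → Congruent _≈_ _≈_ f → Injective _≈_ _≈_ f →
                         Surjective _≈_ _≈_ f
  injective⇒surjective f f-cong f-injective w = to i , λ {z} z≈toi → begin
    f z           ≈⟨ f-cong z≈toi ⟩
    f (to i)      ≈⟨ to∘from _ ⟨
    to (g i)      ≡⟨ P.cong to gi≡w ⟩
    to (from w)   ≈⟨ to∘from w ⟩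
    w             ∎
    where
    g : Fin N → Fin N
    g i = from (f (to i))
    g-injective : Injective _≡_ _≡_ g
    g-injective {i} {j} gi≡gj =
      P.trans (P.sym (from∘to i)) (P.trans (from-cong (f-injective fi≈fj)) (from∘to j))
      where
      fi≈fj : f (to i) ≈ f (to j)
      fi≈fj = trans (sym (to∘from _)) (trans (reflexive (P.cong to gi≡gj)) (to∘from _))
    preimage = fin-injective⇒surjective g g-injective (from w)
    i = proj₁ preimage
    gi≡w = proj₂ preimage

  ×1-^ : ∀ m e → (m ℕ.^ e) × 1# ≈ (m × 1#) ^ e
  ×1-^ m zero    = +-identityʳ 1#
  ×1-^ m (suc e) = trans (×1-homo-* m (m ℕ.^ e)) (*-congˡ (×1-^ m e))

  prime-power-order⇒frobenius : ∀ {p} e → Prime p → N ≡ p ℕ.^ e → Additive p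
  prime-power-order⇒frobenius {p} e pr N≡pᵉ = frobenius pr (^-zero e (begin
    (p × 1#) ^ e     ≈⟨ ×1-^ p e ⟨
    (p ℕ.^ e) × 1#   ≡⟨ P.cong (_× 1#) N≡pᵉ ⟨
    N × 1#           ≈⟨ characteristic ⟩
    0#               ∎))

-- A homogeneous 2×2 system over a field K
--     A (s + 1) + B e = 0,      A f + B (t + 1) = 0
-- has only the trivial solution when s ≠ -1 and t - ef/(s+1) ≠ -1, i.e. when
-- s + 1 and the Schur complement (t + 1) - ef/(s+1) are both nonzero.
module HomogeneousSystem {N : ℕ} (K : FiniteField N) where
  open FiniteField K
  open FiniteFieldTheory K using (zero-product)
  open IntegerCoefficientSolver cring using (solve; _:+_; _:*_; _:-_; _:=_; con)
  open import Algebra.Properties.Ring ring using (+-inverseˡ-unique)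
  open import Data.Product using (_×_)
  open import Relation.Binary.Reasoning.Setoid setoid

  +1≉0 : ∀ {s} → ¬ s ≈ - 1# → ¬ s + 1# ≈ 0#
  +1≉0 s≉-1 s+1≈0 = s≉-1 (+-inverseˡ-unique _ _ s+1≈0)

  trivial-solution : ∀ {A B s e f t} → A * (s + 1#) + B * e ≈ 0# → A * f + B * (t + 1#) ≈ 0# →
                     ¬ s ≈ - 1# → ¬ (t - (e * f) / (s + 1#)) ≈ - 1# → A ≈ 0# × B ≈ 0#
  trivial-solution {A} {B} {s} {e} {f} {t} eq₁ eq₂ s≉-1 schur≉-1 = A≈0 , B≈0
    where
    u = s + 1#
    u≉0 = +1≉0 s≉-1
    -- u · B · (Schur complement) is a linear combination of the two equations.
    combination : ∀ u B t e f v A → u * (B * ((t - (e * f) * v) + 1#)) ≈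
                    (u * (A * f + B * (t + 1#)) - f * (A * u + B * e)) + (B * e * f) * (1# - u * v)
    combination = solve 7 (λ u B t e f v A → u :* (B :* ((t :- (e :* f) :* v) :+ con (+ 1))) :=
                    (u :* (A :* f :+ B :* (t :+ con (+ 1))) :- f :* (A :* u :+ B :* e))
                      :+ (B :* e :* f) :* (con (+ 1) :- u :* v)) refl
    trivial-combination : ∀ u f c → (u * 0# - f * 0#) + c * (1# - 1#) ≈ 0#
    trivial-combination = solve 3 (λ u f c → (u :* con (+ 0) :- f :* con (+ 0))
                                               :+ c :* (con (+ 1) :- con (+ 1)) := con (+ 0)) refl
    u·B·schur≈0 : u * (B * ((t - (e * f) / u) + 1#)) ≈ 0#
    u·B·schur≈0 = begin
      u * (B * ((t - (e * f) * u ⁻¹) + 1#))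
        ≈⟨ combination u B t e f (u ⁻¹) A ⟩
      (u * (A * f + B * (t + 1#)) - f * (A * u + B * e)) + (B * e * f) * (1# - u * u ⁻¹)
        ≈⟨ +-cong (+-cong (*-congˡ eq₂) (-‿cong (*-congˡ eq₁))) (*-congˡ (+-congˡ (-‿cong (⁻¹-inverse u u≉0)))) ⟩
      (u * 0# - f * 0#) + (B * e * f) * (1# - 1#)
        ≈⟨ trivial-combination u f (B * e * f) ⟩
      0# ∎
    B≈0 : B ≈ 0#
    B≈0 with zero-product u·B·schur≈0
    ... | inj₁ u≈0 = ⊥-elim (u≉0 u≈0)
    ... | inj₂ B·schur≈0 with zero-product B·schur≈0
    ...   | inj₁ B≈0     = B≈0
    ...   | inj₂ schur≈0 = ⊥-elim (+1≉0 schur≉-1 schur≈0)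
    A·u≈0 : A * u ≈ 0#
    A·u≈0 = trans (sym (trans (+-congˡ (trans (*-congʳ B≈0) (zeroˡ e))) (+-identityʳ _))) eq₁
    A≈0 : A ≈ 0#
    A≈0 with zero-product A·u≈0
    ... | inj₁ A≈0 = A≈0
    ... | inj₂ u≈0 = ⊥-elim (u≉0 u≈0)

module TraceTheory (q n : ℕ) (K : FiniteField (q ℕ.^ n))
                   (q-additive : AdditivePowers.Additive (FiniteField.cring K) q) where
  open FiniteField K
  open FiniteFieldTheory K
  open IntegerCoefficientSolver cring using (solve; _:+_; _:-_; _:*_; _:=_; con)
  open import Algebra.Properties.Ring ring using (+-cancelʳ)
  open import Relation.Binary.Reasoning.Setoid setoid

  ^ᴷ≈^ : ∀ x e → x ^ᴷ e ≈ x ^ e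
  ^ᴷ≈^ x e = reflexive (^ᴷ≡^ e)
    where
    ^ᴷ≡^ : ∀ e → x ^ᴷ e ≡ x ^ e
    ^ᴷ≡^ zero    = P.refl
    ^ᴷ≡^ (suc e) = P.cong (x *_) (^ᴷ≡^ e)

  ^ᴷ-cong : ∀ e → Congruent _≈_ _≈_ (_^ᴷ e)
  ^ᴷ-cong e {x} {y} x≈y = trans (^ᴷ≈^ x e) (trans (^-congˡ e x≈y) (sym (^ᴷ≈^ y e)))

  ^ᴷ-additive : ∀ e → Additive e → ∀ x y → (x + y) ^ᴷ e ≈ x ^ᴷ e + y ^ᴷ e
  ^ᴷ-additive e e-additive x y =
    trans (^ᴷ≈^ (x + y) e) (trans (e-additive x y) (+-cong (sym (^ᴷ≈^ x e)) (sym (^ᴷ≈^ y e))))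

  ^ᴷ-scalar : ∀ {c} e → c ^ e ≈ c → ∀ y → (c * y) ^ᴷ e ≈ c * y ^ᴷ e
  ^ᴷ-scalar {c} e cᵉ≈c y = trans (^ᴷ≈^ (c * y) e) (trans (^-distrib-* c y e) (*-cong cᵉ≈c (sym (^ᴷ≈^ y e))))

  q^i-additive : ∀ i → Additive (q ℕ.^ i)
  q^i-additive = additive-^ q q-additive

  InFq : Carrier → Set
  InFq c = c ^ q ≈ c

  InFq-^ : ∀ {c} → InFq c → ∀ i → c ^ (q ℕ.^ i) ≈ c
  InFq-^ {c} c^q≈c zero    = ^-identityʳ c
  InFq-^ {c} c^q≈c (suc i) = begin
    c ^ (q ℕ.* q ℕ.^ i)   ≈⟨ ^-assocʳ c q (q ℕ.^ i) ⟨
    (c ^ q) ^ (q ℕ.^ i)   ≈⟨ ^-congˡ (q ℕ.^ i) c^q≈c ⟩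
    c ^ (q ℕ.^ i)         ≈⟨ InFq-^ c^q≈c i ⟩
    c                     ∎

  InFq-sub : ∀ {c d} → InFq c → InFq d → InFq (c - d)
  InFq-sub {c} {d} c^q≈c d^q≈d = trans (additive-sub q q-additive c d) (+-cong c^q≈c (-‿cong d^q≈d))

  Tr-cong : ∀ i → Congruent _≈_ _≈_ (Tr q i)
  Tr-cong zero    y≈z = refl
  Tr-cong (suc i) y≈z = +-cong (Tr-cong i y≈z) (^ᴷ-cong (q ℕ.^ i) y≈z)

  Tr-+ : ∀ i x y → Tr q i (x + y) ≈ Tr q i x + Tr q i y
  Tr-+ zero    x y = sym (+-identityˡ 0#)
  Tr-+ (suc i) x y = trans (+-cong (Tr-+ i x y) (^ᴷ-additive (q ℕ.^ i) (q^i-additive i) x y))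
                           (interchange _ _ _ _)
    where
    interchange : ∀ a b c d → (a + b) + (c + d) ≈ (a + c) + (b + d)
    interchange = solve 4 (λ a b c d → (a :+ b) :+ (c :+ d) := (a :+ c) :+ (b :+ d)) refl

  Tr-scalar : ∀ {c} → InFq c → ∀ i y → Tr q i (c * y) ≈ c * Tr q i y
  Tr-scalar {c} c∈Fq zero    y = sym (zeroʳ c)
  Tr-scalar {c} c∈Fq (suc i) y =
    trans (+-cong (Tr-scalar c∈Fq i y) (^ᴷ-scalar (q ℕ.^ i) (InFq-^ c∈Fq i) y)) (sym (distribˡ c _ _))

  Tr-frobenius : ∀ i y → Tr q i y ^ q + y ≈ Tr q i y + y ^ (q ℕ.^ i)
  Tr-frobenius zero    y = +-cong (additive⇒0^e≈0 q q-additive) (sym (^-identityʳ y))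
  Tr-frobenius (suc i) y = begin
    (Tr q i y + y ^ᴷ (q ℕ.^ i)) ^ q + y               ≈⟨ +-congʳ (q-additive _ _) ⟩
    (Tr q i y ^ q + (y ^ᴷ (q ℕ.^ i)) ^ q) + y         ≈⟨ swap _ _ _ ⟩
    (Tr q i y ^ q + y) + (y ^ᴷ (q ℕ.^ i)) ^ q         ≈⟨ +-cong (Tr-frobenius i y) next-power ⟩
    (Tr q i y + y ^ (q ℕ.^ i)) + y ^ (q ℕ.^ suc i)    ≈⟨ +-congʳ (+-congˡ (^ᴷ≈^ y (q ℕ.^ i))) ⟨
    (Tr q i y + y ^ᴷ (q ℕ.^ i)) + y ^ (q ℕ.^ suc i)   ∎
    where
    swap : ∀ a b c → (a + b) + c ≈ (a + c) + b
    swap = solve 3 (λ a b c → (a :+ b) :+ c := (a :+ c) :+ b) refl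
    next-power : (y ^ᴷ (q ℕ.^ i)) ^ q ≈ y ^ (q ℕ.^ suc i)
    next-power = trans (^-congˡ q (^ᴷ≈^ y (q ℕ.^ i)))
                   (trans (^-assocʳ y (q ℕ.^ i) q) (reflexive (P.cong (y ^_) (ℕP.*-comm (q ℕ.^ i) q))))

  -- The trace lands in F_q, by Fermat's little theorem y^(q^n) = y.
  Tr-InFq : ∀ y → InFq (Tr q n y)
  Tr-InFq y = +-cancelʳ y _ _ (trans (Tr-frobenius n y) (+-congˡ (fermat y)))

  module Linearized .{{_ : ℕ.NonZero q}} (α : Carrier) where
    γ : Carrier
    γ = ((α ^ᴷ q) - α) ^ᴷ (q ℕ.∸ 1)

    M : Carrier → Carrier
    M x = ((x ^ᴷ (q ℕ.^ 2)) - ((1# + γ) * (x ^ᴷ q))) + (γ * x)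

    M-cong : Congruent _≈_ _≈_ M
    M-cong x≈y = +-cong (+-cong (^ᴷ-cong (q ℕ.^ 2) x≈y) (-‿cong (*-congˡ (^ᴷ-cong q x≈y)))) (*-congˡ x≈y)

    M-+ : ∀ x y → M (x + y) ≈ M x + M y
    M-+ x y = trans (+-congʳ (+-cong (^ᴷ-additive (q ℕ.^ 2) (q^i-additive 2) x y)
                                     (-‿cong (*-congˡ (^ᴷ-additive q q-additive x y)))))
                    (regroup _ _ _ _ _ _ _ _)
      where
      regroup : ∀ A B C D h g x y → ((A + B) - h * (C + D)) + g * (x + y) ≈
                                    ((A - h * C) + g * x) + ((B - h * D) + g * y)
      regroup = solve 8 (λ A B C D h g x y → ((A :+ B) :- h :* (C :+ D)) :+ g :* (x :+ y) :=
                                             ((A :- h :* C) :+ g :* x) :+ ((B :- h :* D) :+ g :* y)) refl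

    M-scalar : ∀ {c} → InFq c → ∀ y → M (c * y) ≈ c * M y
    M-scalar c∈Fq y = trans (+-congʳ (+-cong (^ᴷ-scalar (q ℕ.^ 2) (InFq-^ c∈Fq 2) y)
                                              (-‿cong (*-congˡ (^ᴷ-scalar q c∈Fq y)))))
                            (factor _ _ _ _ _ _)
      where
      factor : ∀ c A B h g y → ((c * A) - h * (c * B)) + g * (c * y) ≈ c * ((A - h * B) + g * y)
      factor = solve 6 (λ c A B h g y → ((c :* A) :- h :* (c :* B)) :+ g :* (c :* y) :=
                                        c :* ((A :- h :* B) :+ g :* y)) refl

    M-on-Fq : ∀ {c} → InFq c → M c ≈ 0#
    M-on-Fq {c} c∈Fq = trans (+-congʳ (+-cong (trans (^ᴷ≈^ c (q ℕ.^ 2)) (InFq-^ c∈Fq 2))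
                                               (-‿cong (*-congˡ (trans (^ᴷ≈^ c q) c∈Fq)))))
                             (cancel c γ)
      where
      cancel : ∀ c g → (c - (1# + g) * c) + g * c ≈ 0#
      cancel = solve 2 (λ c g → (c :- (con (+ 1) :+ g) :* c) :+ g :* c := con (+ 0)) refl

    -- With d = α^q - α one has γ·d = d^q = α^(q²) - α^q, which is M(α) = 0.
    M-α : M α ≈ 0#
    M-α = begin
      M α                                    ≈⟨ regroup _ _ _ _ ⟩
      (α ^ᴷ (q ℕ.^ 2) - α ^ᴷ q) - γ * d      ≈⟨ +-congʳ (trans γ·d≈d^q d^q≈α^q²-α^q) ⟨
      γ * d - γ * d                          ≈⟨ -‿inverseʳ _ ⟩
      0#                                     ∎
      where
      d = (α ^ᴷ q) - α
      regroup : ∀ A B g a → (A - (1# + g) * B) + g * a ≈ (A - B) - g * (B - a)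
      regroup = solve 4 (λ A B g a → (A :- (con (+ 1) :+ g) :* B) :+ g :* a := (A :- B) :- g :* (B :- a)) refl
      γ·d≈d^q : γ * d ≈ d ^ q
      γ·d≈d^q = trans (*-comm γ d) (trans (*-congˡ (^ᴷ≈^ d (q ℕ.∸ 1))) (reflexive (P.cong (d ^_) (ℕP.suc-pred q))))
      α^q^q≈α^q² : (α ^ᴷ q) ^ q ≈ α ^ᴷ (q ℕ.^ 2)
      α^q^q≈α^q² = begin
        (α ^ᴷ q) ^ q         ≈⟨ ^-congˡ q (^ᴷ≈^ α q) ⟩
        (α ^ q) ^ q          ≈⟨ ^-assocʳ α q q ⟩
        α ^ (q ℕ.* q)        ≡⟨ P.cong (λ k → α ^ (q ℕ.* k)) (ℕP.*-identityʳ q) ⟨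
        α ^ (q ℕ.^ 2)        ≈⟨ ^ᴷ≈^ α (q ℕ.^ 2) ⟨
        α ^ᴷ (q ℕ.^ 2)       ∎
      d^q≈α^q²-α^q : d ^ q ≈ α ^ᴷ (q ℕ.^ 2) - α ^ᴷ q
      d^q≈α^q²-α^q = trans (additive-sub q q-additive (α ^ᴷ q) α) (+-cong α^q^q≈α^q² (-‿cong (sym (^ᴷ≈^ α q))))

    M-vanishes-on-span : ∀ {a b} → InFq a → InFq b → M (a + b * α) ≈ 0#
    M-vanishes-on-span {a} {b} a∈Fq b∈Fq = begin
      M (a + b * α)        ≈⟨ M-+ a (b * α) ⟩
      M a + M (b * α)      ≈⟨ +-cong (M-on-Fq a∈Fq) (trans (M-scalar b∈Fq α) (*-congˡ M-α)) ⟩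
      0# + b * 0#          ≈⟨ trans (+-identityˡ _) (zeroʳ b) ⟩
      0#                   ∎

  -- F(x) = F(y) forces x - y = a + bα with a, b ∈ F_q
  -- satisfying the homogeneous system of HomogeneousSystem with
  -- s = Tr β₁, e = Tr(αβ₁), f = Tr β₂, t = Tr(αβ₂); so F is injective as soon as
  -- that system has only the trivial solution.
  module Permutation .{{_ : ℕ.NonZero q}} (α : Carrier) (H₁ H₂ : Carrier → Carrier)
                     (H₁-cong : Congruent _≈_ _≈_ H₁) (H₂-cong : Congruent _≈_ _≈_ H₂)
                     (β₁ β₂ : Carrier) where
    open Linearized α
    open import Data.Product using (_×_)

    T : Carrier → Carrier
    T = Tr q n

    A₁ A₂ : Carrier → Carrier
    A₁ x = T (H₁ (M x) + (β₁ * x))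
    A₂ x = T (H₂ (M x) + (β₂ * x))

    F : Carrier → Carrier
    F x = (x + A₁ x) + (α * A₂ x)

    split : ∀ x y → x ≈ (x - y) + y
    split = solve 2 (λ x y → x := (x :- y) :+ y) refl

    F-cong : Congruent _≈_ _≈_ F
    F-cong x≈y = +-cong (+-cong x≈y (component-cong H₁-cong β₁ x≈y)) (*-congˡ (component-cong H₂-cong β₂ x≈y))
      where
      component-cong : ∀ {H} → Congruent _≈_ _≈_ H → ∀ β → Congruent _≈_ _≈_ (λ x → T (H (M x) + β * x))
      component-cong H-cong β x≈y = Tr-cong n (+-cong (H-cong (M-cong x≈y)) (*-congˡ x≈y))

    component-difference : ∀ {H} → Congruent _≈_ _≈_ H → ∀ β {x y} → M x ≈ M y →
                           T (H (M x) + β * x) - T (H (M y) + β * y) ≈ T (β * (x - y))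
    component-difference {H} H-cong β {x} {y} Mx≈My = begin
      T (H (M x) + β * x) - T (H (M y) + β * y)
        ≈⟨ +-cong (trans (Tr-+ n _ _) (+-cong (Tr-cong n (H-cong Mx≈My)) βx≈βz+βy)) (-‿cong (Tr-+ n _ _)) ⟩
      (T (H (M y)) + (T (β * (x - y)) + T (β * y))) - (T (H (M y)) + T (β * y))
        ≈⟨ cancel _ _ _ ⟩
      T (β * (x - y))  ∎
      where
      βx≈βz+βy : T (β * x) ≈ T (β * (x - y)) + T (β * y)
      βx≈βz+βy = trans (Tr-cong n (trans (*-congˡ (split x y)) (distribˡ β _ y))) (Tr-+ n _ _)
      cancel : ∀ u v w → (u + (v + w)) - (u + w) ≈ v
      cancel = solve 3 (λ u v w → (u :+ (v :+ w)) :- (u :+ w) := v) refl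

    F-injective : (∀ {a b} → a * (T β₁ + 1#) + b * T (α * β₁) ≈ 0# →
                             a * T β₂ + b * (T (α * β₂) + 1#) ≈ 0# → a ≈ 0# × b ≈ 0#) →
                  Injective _≈_ _≈_ F
    F-injective only-trivial {x} {y} Fx≈Fy = x∙y⁻¹≈ε⇒x≈y x y (begin
      x - y              ≈⟨ x-y≈a+bα ⟩
      a + b * α          ≈⟨ +-cong a≈0 (trans (*-congʳ b≈0) (zeroˡ α)) ⟩
      0# + 0#            ≈⟨ +-identityˡ 0# ⟩
      0#                 ∎)
      where
      open import Algebra.Properties.Ring ring using (x∙y⁻¹≈ε⇒x≈y)
      a = A₁ y - A₁ x
      b = A₂ y - A₂ x
      a∈Fq : InFq a
      a∈Fq = InFq-sub (Tr-InFq _) (Tr-InFq _)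
      b∈Fq : InFq b
      b∈Fq = InFq-sub (Tr-InFq _) (Tr-InFq _)
      x-y≈a+bα : x - y ≈ a + b * α
      x-y≈a+bα = trans (decompose x y (A₁ x) (A₁ y) (A₂ x) (A₂ y) α)
                       (trans (+-congˡ (x≈y⇒x∙y⁻¹≈ε Fx≈Fy)) (+-identityʳ _))
        where
        open import Algebra.Properties.Ring ring using (x≈y⇒x∙y⁻¹≈ε)
        decompose : ∀ x y u u′ v v′ α → x - y ≈
                      ((u′ - u) + (v′ - v) * α) + (((x + u) + α * v) - ((y + u′) + α * v′))
        decompose = solve 7 (λ x y u u′ v v′ α → x :- y :=
                      ((u′ :- u) :+ (v′ :- v) :* α) :+ (((x :+ u) :+ α :* v) :- ((y :+ u′) :+ α :* v′))) refl
      Mx≈My : M x ≈ M y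
      Mx≈My = begin
        M x                ≈⟨ M-cong (split x y) ⟩
        M ((x - y) + y)    ≈⟨ M-+ (x - y) y ⟩
        M (x - y) + M y    ≈⟨ +-congʳ (trans (M-cong x-y≈a+bα) (M-vanishes-on-span a∈Fq b∈Fq)) ⟩
        0# + M y           ≈⟨ +-identityˡ _ ⟩
        M y                ∎
      difference : ∀ {H} → Congruent _≈_ _≈_ H → ∀ β →
                   T (H (M x) + β * x) - T (H (M y) + β * y) ≈ a * T β + b * T (α * β)
      difference {H} H-cong β = begin
        T (H (M x) + β * x) - T (H (M y) + β * y)  ≈⟨ component-difference H-cong β Mx≈My ⟩
        T (β * (x - y))                            ≈⟨ Tr-cong n (trans (*-congˡ x-y≈a+bα) (expand β a b α)) ⟩
        T (a * β + b * (α * β))                    ≈⟨ Tr-+ n _ _ ⟩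
        T (a * β) + T (b * (α * β))                ≈⟨ +-cong (Tr-scalar a∈Fq n β) (Tr-scalar b∈Fq n (α * β)) ⟩
        a * T β + b * T (α * β)                    ∎
        where
        expand : ∀ β a b α → β * (a + b * α) ≈ a * β + b * (α * β)
        expand = solve 4 (λ β a b α → β :* (a :+ b :* α) := a :* β :+ b :* (α :* β)) refl
      -- adding back the difference (u - v) + (v - u) = 0 yields the system
      opposite : ∀ u v → (u - v) + (v - u) ≈ 0#
      opposite = solve 2 (λ u v → (u :- v) :+ (v :- u) := con (+ 0)) refl
      shift₁ : ∀ a s b t → a * (s + 1#) + b * t ≈ (a * s + b * t) + a
      shift₁ = solve 4 (λ a s b t → a :* (s :+ con (+ 1)) :+ b :* t := (a :* s :+ b :* t) :+ a) refl
      shift₂ : ∀ a s b t → a * s + b * (t + 1#) ≈ (a * s + b * t) + b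
      shift₂ = solve 4 (λ a s b t → a :* s :+ b :* (t :+ con (+ 1)) := (a :* s :+ b :* t) :+ b) refl
      equation₁ : a * (T β₁ + 1#) + b * T (α * β₁) ≈ 0#
      equation₁ = trans (shift₁ a _ b _) (trans (+-congʳ (sym (difference H₁-cong β₁))) (opposite _ _))
      equation₂ : a * T β₂ + b * (T (α * β₂) + 1#) ≈ 0#
      equation₂ = trans (shift₂ a _ b _) (trans (+-congʳ (sym (difference H₂-cong β₂))) (opposite _ _))
      a≈0 = proj₁ (only-trivial equation₁ equation₂)
      b≈0 = proj₂ (only-trivial equation₁ equation₂)

open import Data.Nat using (_≤_; _^_; _∸_)
open import Data.Product using (_×_; swap)
open import Data.Sum using ([_,_]′)

mainTheorem13 : (q n : ℕ) → IsPrimePower q → 1 ≤ n →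
    (K : FiniteField (q ^ n)) →
    let open FiniteField K
        T = Tr q n in
    (α : Carrier) → ¬ ((α ^ᴷ q) ≈ α) →
    (H₁ H₂ : Carrier → Carrier) → Congruent _≈_ _≈_ H₁ → Congruent _≈_ _≈_ H₂ →
    (β₁ β₂ : Carrier) →
    let γ = (((α ^ᴷ q) - α) ^ᴷ (q ∸ 1))
        M = λ (x : Carrier) → ((x ^ᴷ (q ^ 2)) - ((1# + γ) * (x ^ᴷ q))) + (γ * x)
        F = λ (x : Carrier) → (x + T (H₁ (M x) + (β₁ * x))) + (α * T (H₂ (M x) + (β₂ * x)))
    in
    ((¬ (T β₁ ≈ (- 1#)) × ¬ ((T (α * β₂) - ((T (α * β₁) * T β₂) / (T β₁ + 1#))) ≈ (- 1#)))
     ⊎ (¬ (T (α * β₂) ≈ (- 1#)) × ¬ ((T β₁ - ((T β₂ * T (α * β₁)) / (T (α * β₂) + 1#))) ≈ (- 1#)))) →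
    Bijective _≈_ _≈_ F
mainTheorem13 q n (p , k , p-prime , _ , q≡pᵏ) _ K α _ H₁ H₂ H₁-cong H₂-cong β₁ β₂ condition =
  F-injective only-trivial , injective⇒surjective F F-cong (F-injective only-trivial)
  where
  open FiniteField K
  open FiniteFieldTheory K
  -- q = p^k, so |K| = p^(kn) and the Frobenius x ↦ x^q is additive
  instance
    q≢0 : ℕ.NonZero q
    q≢0 = P.subst ℕ.NonZero (P.sym q≡pᵏ) (ℕP.m^n≢0 p k {{prime⇒nonZero p-prime}})
  q-additive : Additive q
  q-additive = P.subst Additive (P.sym q≡pᵏ) (additive-^ p (prime-power-order⇒frobenius (k ℕ.* n) p-prime
                 (P.trans (P.cong (ℕ._^ n) q≡pᵏ) (ℕP.^-*-assoc p k n))) k)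
  open TraceTheory q n K q-additive
  open Permutation α H₁ H₂ H₁-cong H₂-cong β₁ β₂
  open HomogeneousSystem K
  -- under (i) the system is solved directly, under (ii) with the unknowns swapped
  only-trivial : ∀ {a b} → a * (T β₁ + 1#) + b * T (α * β₁) ≈ 0# →
                 a * T β₂ + b * (T (α * β₂) + 1#) ≈ 0# → a ≈ 0# × b ≈ 0#
  only-trivial eq₁ eq₂ =
    [ (λ (s≉-1 , schur≉-1) → trivial-solution eq₁ eq₂ s≉-1 schur≉-1)
    , (λ (t≉-1 , schur≉-1) →
         swap (trivial-solution (trans (+-comm _ _) eq₂) (trans (+-comm _ _) eq₁) t≉-1 schur≉-1))
    ]′ condition
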